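{- Let $\mathcal{G}=(V,V_i,V_t,P)$ be a production grammar that is well-formed, has no production with an empty side, has no terminal on the left side of any production, is normal, and in which every production whose right side contains a terminal symbol has as right side a single terminal symbol. Suppose $\sigma'$ is reachable from a symbol of $V_i$ by leftmost reductions and $\sigma'\longrightarrow\sigma$ by a leftmost reduction that produces a terminal symbol $t$. Then every symbol of $\sigma$ to the left of this produced occurrence of $t$ is a terminal symbol.
   Context: A production grammar is $\mathcal{G}=(V,V_i,V_t,P)$ with $V$ a finite alphabet, $V_i,V_t\subseteq V$ (initial and terminal vocabularies) and $P$ a finite set of pairs $(\Gamma,\Delta)$ of strings over $V$, written $\Gamma\to\Delta$. Elements of $V_t$ are terminals, others nonterminals; a sentence is a string of terminals. A production $\Gamma\to\Delta$ is applicable to $\sigma$ if $\sigma=\sigma_1\Gamma\sigma_2$; its application gives $\sigma_1\Delta\sigma_2$. It is leftmost applicable (at the occurrence $\sigma=\sigma_1\Gamma\sigma_2$) if for every production $\Gamma'\to\Delta'$ and every decomposition $\sigma=\gamma_1\Gamma'\gamma_2$ one has $|\Gamma|\le|\Gamma'|$ and $|\sigma_1|\le|\gamma_1|$. Write $\sigma\longrightarrow\sigma'$ if some production is leftmost applicable to $\sigma$ and $\sigma'$ is the result of that application. Well-formed means every reduction sequence ultimately leads to a sentence. Normal means both sides of every production have length 1 or 2. -}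

module Defs where

open import Data.Nat using (ℕ; _≤_)
open import Data.Fin using (Fin)
open import Data.Fin.Subset using (Subset; _∈_; _∉_)
open import Data.List using (List; []; _∷_; _++_; length)
open import Data.List.Relation.Unary.All using (All)
open import Data.List.Relation.Unary.Any using (Any)
import Data.List.Membership.Propositional as LM
open import Data.Product using (Σ; ∃; _×_; _,_; proj₁; proj₂)
open import Data.Sum using (_⊎_)
open import Relation.Binary.PropositionalEquality using (_≡_; _≢_)
open import Relation.Binary.Construct.Closure.ReflexiveTransitive using (Star)

Symbol : ℕ → Set
Symbol n = Fin n

String : ℕ → Set
String n = List (Symbol n)

Production : ℕ → Set
Production n = String n × String n

-- A production grammar (V, V_i, V_t, P) over the alphabet V = Fin n.
record Grammar (n : ℕ) : Set where
  field
    Vi : Subset n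
    Vt : Subset n
    P  : List (Production n)
open Grammar public

module _ {n : ℕ} (G : Grammar n) where

  InP : Production n → Set
  InP p = LM._∈_ p (P G)

  Sentence : String n → Set
  Sentence σ = All (λ x → x ∈ Vt G) σ

  LeftmostApplicable : String n → Production n → String n → String n → Set
  LeftmostApplicable σ (Γ , Δ) σ₁ σ₂ =
    (σ ≡ σ₁ ++ Γ ++ σ₂) ×
    (∀ Γ' Δ' γ₁ γ₂ → InP (Γ' , Δ') → σ ≡ γ₁ ++ Γ' ++ γ₂ →
       (length Γ ≤ length Γ') × (length σ₁ ≤ length γ₁))

  _⟶_ : String n → String n → Set
  σ ⟶ σ' = Σ (Production n) λ p → Σ (String n) λ σ₁ → Σ (String n) λ σ₂ →
    InP p × LeftmostApplicable σ p σ₁ σ₂ × (σ' ≡ σ₁ ++ proj₂ p ++ σ₂)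

  _⟶*_ : String n → String n → Set
  _⟶*_ = Star _⟶_

  -- "Every reduction sequence from σ ultimately leads to a sentence":
  -- inductively, either σ is a sentence, or σ can be reduced and every
  -- leftmost reduction of σ again leads to a sentence.
  data LeadsToSentence (σ : String n) : Set where
    done : Sentence σ → LeadsToSentence σ
    next : (∃ λ σ' → σ ⟶ σ') →
           (∀ σ' → σ ⟶ σ' → LeadsToSentence σ') → LeadsToSentence σ

  WellFormed : Set
  WellFormed = ∀ v → v ∈ Vi G → LeadsToSentence (v ∷ [])

  NoEmptySide : Set
  NoEmptySide = ∀ Γ Δ → InP (Γ , Δ) → (Γ ≢ []) × (Δ ≢ [])

  NoTerminalOnLeft : Set
  NoTerminalOnLeft = ∀ Γ Δ → InP (Γ , Δ) → All (λ x → x ∉ Vt G) Γ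

  Len12 : String n → Set
  Len12 s = (length s ≡ 1) ⊎ (length s ≡ 2)

  Normal : Set
  Normal = ∀ Γ Δ → InP (Γ , Δ) → Len12 Γ × Len12 Δ

  TerminalRightSingle : Set
  TerminalRightSingle = ∀ Γ Δ → InP (Γ , Δ) → Any (λ x → x ∈ Vt G) Δ →
    Σ (Symbol n) λ t → (t ∈ Vt G) × (Δ ≡ t ∷ [])

-- Leftmostness of the reduction at σ₁ means that no left side occurs inside σ₁.
-- Left sides are nonempty and contain no terminal, so no later redex can lie
-- inside σ₁ or overlap the produced terminal t: every subsequent leftmost
-- reduction acts strictly to the right of t, and the prefix σ₁ t is frozen.
-- By well-formedness the reductions end in a sentence, which begins with σ₁.
module Submission where

open import Defs
open import Data.Nat using (ℕ; _<_; _≤_; z<s; s<s)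
open import Data.Nat.Properties using (<⇒≱)
open import Data.Fin.Subset using (_∈_)
open import Data.List using (List; []; _∷_; _++_; length)
open import Data.List.Properties using (++-assoc; ∷-injective)
open import Data.List.Relation.Unary.All using (All; _∷_)
import Data.List.Relation.Unary.All as All
open import Data.List.Relation.Unary.All.Properties using (++⁻ˡ; ++⁻ʳ)
open import Data.List.Relation.Unary.Any using (here; there)
open import Data.List.Membership.Propositional using () renaming (_∈_ to _∈ₗ_)
open import Data.Product using (∃; _,_; proj₁; proj₂)
open import Data.Sum using (_⊎_; inj₁; inj₂)
open import Relation.Nullary using (¬_; contradiction)
open import Relation.Binary.PropositionalEquality using (_≡_; _≢_; refl; trans; cong)
open import Relation.Binary.Construct.Closure.ReflexiveTransitive using (ε; _◅_)

module _ {A : Set} where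

  length-<-++-∷ : ∀ (xs : List A) y ys → length xs < length (xs ++ y ∷ ys)
  length-<-++-∷ []       y ys = z<s
  length-<-++-∷ (x ∷ xs) y ys = s<s (length-<-++-∷ xs y ys)

  prefix-split : ∀ s (t : A) ρ Γ γ₂ → s ++ t ∷ ρ ≡ Γ ++ γ₂ →
                 (∃ λ m → s ≡ Γ ++ m) ⊎ t ∈ₗ Γ
  prefix-split s       t ρ []      γ₂ eq = inj₁ (s , refl)
  prefix-split []      t ρ (x ∷ Γ) γ₂ eq = inj₂ (here (∷-injective eq .proj₁))
  prefix-split (y ∷ s) t ρ (x ∷ Γ) γ₂ eq with ∷-injective eq
  ... | refl , eq′ with prefix-split s t ρ Γ γ₂ eq′
  ...   | inj₁ (m , s≡Γm) = inj₁ (m , cong (y ∷_) s≡Γm)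
  ...   | inj₂ t∈Γ        = inj₂ (there t∈Γ)

  infix-split : ∀ s (t : A) ρ γ₁ Γ γ₂ → s ++ t ∷ ρ ≡ γ₁ ++ Γ ++ γ₂ →
                (∃ λ m → s ≡ γ₁ ++ Γ ++ m) ⊎ t ∈ₗ Γ ⊎ (∃ λ μ → γ₁ ≡ s ++ t ∷ μ)
  infix-split s       t ρ []       Γ γ₂ eq with prefix-split s t ρ Γ γ₂ eq
  ... | inj₁ inside = inj₁ inside
  ... | inj₂ t∈Γ    = inj₂ (inj₁ t∈Γ)
  infix-split []      t ρ (y ∷ γ₁) Γ γ₂ eq with ∷-injective eq
  ... | refl , _ = inj₂ (inj₂ (γ₁ , refl))
  infix-split (x ∷ s) t ρ (y ∷ γ₁) Γ γ₂ eq with ∷-injective eq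
  ... | refl , eq′ with infix-split s t ρ γ₁ Γ γ₂ eq′
  ...   | inj₁ (m , e)        = inj₁ (m , cong (x ∷_) e)
  ...   | inj₂ (inj₁ t∈Γ)     = inj₂ (inj₁ t∈Γ)
  ...   | inj₂ (inj₂ (μ , e)) = inj₂ (inj₂ (μ , cong (x ∷_) e))

module _ {n : ℕ} (G : Grammar n) where

  RedexFree : String n → Set
  RedexFree σ = ∀ Γ Δ γ₁ γ₂ → InP G (Γ , Δ) → σ ≢ γ₁ ++ Γ ++ γ₂

  redexFree⇒¬⟶ : ∀ {σ τ} → RedexFree σ → ¬ _⟶_ G σ τ
  redexFree⇒¬⟶ free ((Γ , Δ) , σ₁ , σ₂ , Γ→Δ , (σ≡σ₁Γσ₂ , _) , _) =
    free Γ Δ σ₁ σ₂ Γ→Δ σ≡σ₁Γσ₂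

  sentence⇒redexFree : NoEmptySide G → NoTerminalOnLeft G →
                       ∀ {σ} → Sentence G σ → RedexFree σ
  sentence⇒redexFree noEmpty noTerm sentence Γ Δ γ₁ γ₂ Γ→Δ refl
    with Γ | noEmpty Γ Δ Γ→Δ | noTerm Γ Δ Γ→Δ
  ... | []    | Γ≢[] , _ | _         = Γ≢[] refl
  ... | x ∷ _ | _        | x∉Vt ∷ _ = x∉Vt (All.head (++⁻ʳ γ₁ sentence))

  leftmost⇒prefix-redexFree : NoEmptySide G →
    ∀ σ Γ Δ σ₁ σ₂ → LeftmostApplicable G σ (Γ , Δ) σ₁ σ₂ → RedexFree σ₁
  leftmost⇒prefix-redexFree noEmpty _ _ _ _ _ _ [] Δ′ γ₁ m Γ′→Δ′ refl =
    noEmpty [] Δ′ Γ′→Δ′ .proj₁ refl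
  leftmost⇒prefix-redexFree noEmpty σ Γ _ _ σ₂ (σ≡σ₁Γσ₂ , leftmost)
                            (x ∷ Γ″) Δ′ γ₁ m Γ′→Δ′ refl =
    <⇒≱ (length-<-++-∷ γ₁ x (Γ″ ++ m)) σ₁-not-left-of-γ₁
    where
    σ≡γ₁Γ′mΓσ₂ : σ ≡ γ₁ ++ (x ∷ Γ″) ++ m ++ Γ ++ σ₂
    σ≡γ₁Γ′mΓσ₂ = trans σ≡σ₁Γσ₂ (trans (++-assoc γ₁ (x ∷ Γ″ ++ m) (Γ ++ σ₂))
                                   (cong (λ r → γ₁ ++ x ∷ r) (++-assoc Γ″ m (Γ ++ σ₂))))
    σ₁-not-left-of-γ₁ : length (γ₁ ++ (x ∷ Γ″) ++ m) ≤ length γ₁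
    σ₁-not-left-of-γ₁ = leftmost (x ∷ Γ″) Δ′ γ₁ (m ++ Γ ++ σ₂) Γ′→Δ′ σ≡γ₁Γ′mΓσ₂ .proj₂

  leadsToSentence-⟶ : NoEmptySide G → NoTerminalOnLeft G → ∀ {σ τ} →
                      LeadsToSentence G σ → _⟶_ G σ τ → LeadsToSentence G τ
  leadsToSentence-⟶ noEmpty noTerm (done sentence) step =
    contradiction step (redexFree⇒¬⟶ (sentence⇒redexFree noEmpty noTerm sentence))
  leadsToSentence-⟶ noEmpty noTerm (next _ continue) step = continue _ step

  leadsToSentence-⟶* : NoEmptySide G → NoTerminalOnLeft G → ∀ {σ τ} →
                       LeadsToSentence G σ → _⟶*_ G σ τ → LeadsToSentence G τ
  leadsToSentence-⟶* noEmpty noTerm leads ε = leads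
  leadsToSentence-⟶* noEmpty noTerm leads (step ◅ steps) =
    leadsToSentence-⟶* noEmpty noTerm (leadsToSentence-⟶ noEmpty noTerm leads step) steps

  ⟶-keeps-prefix : NoTerminalOnLeft G → ∀ {σ₁ t ρ τ} → RedexFree σ₁ → t ∈ Vt G →
                   _⟶_ G (σ₁ ++ t ∷ ρ) τ → ∃ λ ρ′ → τ ≡ σ₁ ++ t ∷ ρ′
  ⟶-keeps-prefix noTerm {σ₁} {t} {ρ} free t∈Vt
                 ((Γ , Δ) , γ₁ , γ₂ , Γ→Δ , (eq , _) , refl)
    with infix-split σ₁ t ρ γ₁ Γ γ₂ eq
  ... | inj₁ (m , σ₁≡γ₁Γm)     = contradiction σ₁≡γ₁Γm (free Γ Δ γ₁ m Γ→Δ)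
  ... | inj₂ (inj₁ t∈Γ)        = contradiction t∈Vt (All.lookup (noTerm Γ Δ Γ→Δ) t∈Γ)
  ... | inj₂ (inj₂ (μ , refl)) = μ ++ Δ ++ γ₂ , ++-assoc σ₁ (t ∷ μ) (Δ ++ γ₂)

  leadsToSentence⇒prefix-sentence : NoTerminalOnLeft G → ∀ {σ₁ t ρ} →
    RedexFree σ₁ → t ∈ Vt G → LeadsToSentence G (σ₁ ++ t ∷ ρ) → Sentence G σ₁
  leadsToSentence⇒prefix-sentence noTerm {σ₁} free t∈Vt (done sentence) =
    ++⁻ˡ σ₁ sentence
  leadsToSentence⇒prefix-sentence noTerm free t∈Vt (next (_ , step) continue)
    with ⟶-keeps-prefix noTerm free t∈Vt step
  ... | _ , refl = leadsToSentence⇒prefix-sentence noTerm free t∈Vt (continue _ step)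

mainTheorem2 : ∀ {n : ℕ} (G : Grammar n) →
    WellFormed G → NoEmptySide G → NoTerminalOnLeft G → Normal G →
    TerminalRightSingle G →
    ∀ (v : Symbol n) (σ' : String n) (Γ Δ σ₁ σ₂ : String n) (t : Symbol n) →
    v ∈ Vi G →
    _⟶*_ G (v ∷ []) σ' →
    InP G (Γ , Δ) →
    LeftmostApplicable G σ' (Γ , Δ) σ₁ σ₂ →
    Δ ≡ t ∷ [] → t ∈ Vt G →
    All (λ x → x ∈ Vt G) σ₁
mainTheorem2 G wellFormed noEmpty noTerm _ _ v σ′ Γ Δ σ₁ σ₂ t
             v∈Vi v⟶*σ′ Γ→Δ leftmost refl t∈Vt =
  leadsToSentence⇒prefix-sentence G noTerm
    (leftmost⇒prefix-redexFree G noEmpty σ′ Γ Δ σ₁ σ₂ leftmost) t∈Vt σ-leadsToSentence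
  where
  σ′-leadsToSentence : LeadsToSentence G σ′
  σ′-leadsToSentence = leadsToSentence-⟶* G noEmpty noTerm (wellFormed v v∈Vi) v⟶*σ′

  σ-leadsToSentence : LeadsToSentence G (σ₁ ++ t ∷ σ₂)
  σ-leadsToSentence = leadsToSentence-⟶ G noEmpty noTerm σ′-leadsToSentence
                        ((Γ , t ∷ []) , σ₁ , σ₂ , Γ→Δ , leftmost , refl)
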